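{- Let $\lambda$ be a partition (straight shape) of Frobenius rank $k$, and let $\mu$ be a partition. Then $$c_\mu\,p_\mu=(-1)^{z(\lambda)}\sum(-1)^{c(\mathcal{I})}x^{(\mathcal{I},\alpha)},$$ where the sum ranges over all labelled interval sets $(\mathcal{I},\alpha)$ of $\lambda$ of type $\mu$, and $c_\mu=(-1)^{z(\lambda)}\sum_{\mathcal{I}}(-1)^{c(\mathcal{I})}$ with the sum over all interval sets $\mathcal{I}$ of $\lambda$ of type $\mu$.
   Context: Young diagram $\lambda=\{(i,j):1\le j\le\lambda_i\}$; $\mathrm{rank}(\lambda)$ is the largest $i$ with $\lambda_i\ge i$. Edges of the lower envelope: unit edges that are the lower or right-hand edge of some square of $\lambda$ but not the upper or left-hand edge of any square of $\lambda$, ordered from lower left to upper right. Snake of such an edge $e$: if $e$ is horizontal and is the lower edge of $(i,j)\in\lambda$, $S_e=\lambda\cap\{(i,j),(i,j-1),(i-1,j-1),(i-1,j-2),\ldots\}$; if $e$ is vertical and is the right-hand edge of $(i,j)\in\lambda$, $S_e=\lambda\cap\{(i,j),(i-1,j),(i-1,j-1),(i-2,j-1),\ldots\}$; its length is its number of squares minus one. The snake sequence $\mathrm{SS}(\lambda)=q_1\cdots q_m$ records, in order, $L$ for an even-length snake of a horizontal edge, $R$ for an even-length snake of a vertical edge, $O$ for an odd-length snake. An interval set of $\lambda$ is a set $\mathcal{I}=\{(u_1,v_1),\ldots,(u_k,v_k)\}$ with all $u_i,v_i$ distinct, $1\le u_i<v_i\le m$, $q_{u_i}=L$, $q_{v_i}=R$;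 its type is the partition obtained by sorting $(v_1-u_1,\ldots,v_k-u_k)$ in weakly decreasing order; its crossing number $c(\mathcal{I})$ is the number of pairs $(i,j)$ with $u_i<u_j<v_i<v_j$. A labelled interval set assigns to each interval $(u_i,v_i)$ a positive integer label $\alpha_i$, and $x^{(\mathcal{I},\alpha)}=\prod_i x_{\alpha_i}^{v_i-u_i}$. A border strip is a connected skew shape with no $2\times2$ square; its height is its number of rows minus one. $z(\lambda)$ is the sum of the heights of the border strips in a greedy border strip tableau of $\lambda$, obtained by starting from $\lambda$ and successively removing a largest possible border strip (so that a partition remains each time); this sum is independent of the choices. $p_\mu=\prod_i p_{\mu_i}$ with $p_r=\sum_j x_j^r$. -}

module Defs where

open import Data.Bool using (Bool; true; false; if_then_else_; _∧_; not)
open import Data.Nat using (ℕ; zero; suc; _+_; _∸_; _≤_; _<_; _≤ᵇ_; _<ᵇ_; _≡ᵇ_; _⊔_)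
open import Data.Nat.Properties using ()
open import Data.Integer as ℤ using (ℤ; -1ℤ; 0ℤ; 1ℤ)
open import Data.Fin using (Fin)
open import Data.Nat.ListAction using (sum)
open import Data.List using (List; []; _∷_; _++_; map; length; foldr; filterᵇ;
  applyUpTo; downFrom; concatMap; cartesianProduct; zipWith; allFin)
open import Data.List.Relation.Unary.All using (All)
open import Data.List.Relation.Unary.Linked using (Linked)
open import Data.List.Relation.Unary.Unique.Propositional using (Unique)
open import Data.List.Relation.Binary.Permutation.Propositional using (_↭_)
open import Data.Maybe using (Maybe; just; nothing)
open import Data.Product using (_×_; _,_; proj₁; proj₂; ∃)
open import Data.Sum using (_⊎_)
open import Relation.Nullary using (¬_)
open import Relation.Binary.PropositionalEquality using (_≡_)
open import Relation.Binary.Construct.Closure.ReflexiveTransitive using (Star)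

-- Partitions (Young diagrams), English convention: row 1 on top,
-- cell (i , j) = row i, column j, both 1-indexed.

-- part la i = la_i  (1-indexed; 0 outside 1..length la)
part : List ℕ → ℕ → ℕ
part []       _             = 0
part (x ∷ xs) zero          = 0
part (x ∷ xs) (suc zero)    = x
part (x ∷ xs) (suc (suc n)) = part xs (suc n)

IsPartition : List ℕ → Set
IsPartition la = Linked (λ a b → b ≤ a) la × All (λ n → 1 ≤ n) la

Cell : Set
Cell = ℕ × ℕ

inDiagramᵇ : List ℕ → Cell → Bool
inDiagramᵇ la (i , j) = (1 ≤ᵇ i) ∧ ((1 ≤ᵇ j) ∧ (j ≤ᵇ part la i))

rank : List ℕ → ℕ
rank la = foldr _⊔_ 0 (filterᵇ (λ i → i ≤ᵇ part la i) (applyUpTo suc (length la)))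

data Edge : Set where
  hor : ℕ → ℕ → Edge   -- hor i j : lower edge of square (i , j)
  ver : ℕ → ℕ → Edge   -- ver i j : right-hand edge of square (i , j)

colsBetween : ℕ → ℕ → List ℕ
colsBetween lo hi = applyUpTo (λ t → suc (lo + t)) (hi ∸ lo)

-- edges of the lower envelope met while passing row i:
-- lower edges of (i , j) for la_{i+1} < j ≤ la_i, then right edge of (i , la_i)
rowEdges : List ℕ → ℕ → List Edge
rowEdges la i = map (hor i) (colsBetween (part la (suc i)) (part la i))
                ++ (ver i (part la i) ∷ [])

-- all edges of the lower envelope, ordered from lower left to upper right
-- (rows ℓ, ℓ-1, ..., 1 where ℓ = length la)
envelope : List ℕ → List Edge
envelope la = concatMap (rowEdges la) (map suc (downFrom (length la)))

-- The cells (i,j),(i,j-1),(i-1,j-1),(i-1,j-2),...  (goLeft)  resp.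
-- (i,j),(i-1,j),(i-1,j-1),(i-2,j-1),...  (goUp), listed as long as both
-- coordinates are positive (all later cells have a non-positive
-- coordinate, hence are not in any diagram).
mutual
  goLeft : ℕ → ℕ → List Cell
  goLeft zero    _       = []
  goLeft (suc i) zero    = []
  goLeft (suc i) (suc j) = (suc i , suc j) ∷ goUp (suc i) j

  goUp : ℕ → ℕ → List Cell
  goUp zero    _       = []
  goUp (suc i) zero    = []
  goUp (suc i) (suc j) = (suc i , suc j) ∷ goLeft i (suc j)

snakeSeq : Edge → List Cell
snakeSeq (hor i j) = goLeft i j
snakeSeq (ver i j) = goUp i j

snakeLength : List ℕ → Edge → ℕ
snakeLength la e = length (filterᵇ (inDiagramᵇ la) (snakeSeq e)) ∸ 1

evenᵇ : ℕ → Bool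
evenᵇ zero          = true
evenᵇ (suc zero)    = false
evenᵇ (suc (suc n)) = evenᵇ n

data Letter : Set where
  L R O : Letter

snakeLetter : List ℕ → Edge → Letter
snakeLetter la e with evenᵇ (snakeLength la e)
snakeLetter la (hor _ _) | true  = L
snakeLetter la (ver _ _) | true  = R
snakeLetter la e         | false = O

SS : List ℕ → List Letter
SS la = map (snakeLetter la) (envelope la)

-- 1-indexed lookup
at : {A : Set} → List A → ℕ → Maybe A
at []       _             = nothing
at (x ∷ xs) zero          = nothing
at (x ∷ xs) (suc zero)    = just x
at (x ∷ xs) (suc (suc n)) = at xs (suc n)

Interval : Set
Interval = ℕ × ℕ

endpoints : List Interval → List ℕ
endpoints = concatMap (λ uv → proj₁ uv ∷ proj₂ uv ∷ [])

-- A set of intervals is represented by the list of its elements sorted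
-- by strictly increasing left endpoint u (canonical representative).
IsIntervalSet : List Letter → List Interval → Set
IsIntervalSet q I =
  All (λ uv → 1 ≤ proj₁ uv × proj₁ uv < proj₂ uv × proj₂ uv ≤ length q
              × at q (proj₁ uv) ≡ just L × at q (proj₂ uv) ≡ just R) I
  × Unique (endpoints I)
  × Linked (λ a b → proj₁ a < proj₁ b) I

-- type: the lengths v_i - u_i, sorted weakly decreasingly, equal mu
-- (mu being a partition, this says the lengths are a rearrangement of mu)
OfType : List ℕ → List Interval → Set
OfType mu I = map (λ uv → proj₂ uv ∸ proj₁ uv) I ↭ mu

crossesᵇ : Interval × Interval → Bool
crossesᵇ ((u₁ , v₁) , (u₂ , v₂)) = (u₁ <ᵇ u₂) ∧ ((u₂ <ᵇ v₁) ∧ (v₁ <ᵇ v₂))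

crossing : List Interval → ℕ
crossing I = length (filterᵇ crossesᵇ (cartesianProduct I I))

_⊆ₚ_ : List ℕ → List ℕ → Set
nu ⊆ₚ la = ∀ i → part nu i ≤ part la i

InSkew : List ℕ → List ℕ → Cell → Set
InSkew la nu (i , j) = 1 ≤ i × 1 ≤ j × j ≤ part la i × part nu i < j

Adjacent : Cell → Cell → Set
Adjacent (i , j) (i' , j') =
  (i ≡ i' × (suc j ≡ j' ⊎ suc j' ≡ j)) ⊎ (j ≡ j' × (suc i ≡ i' ⊎ suc i' ≡ i))

SkewAdj : List ℕ → List ℕ → Cell → Cell → Set
SkewAdj la nu a b = InSkew la nu a × InSkew la nu b × Adjacent a b

IsBorderStrip : List ℕ → List ℕ → Set
IsBorderStrip la nu =
  IsPartition nu × nu ⊆ₚ la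
  × ∃ (InSkew la nu)
  × (∀ a b → InSkew la nu a → InSkew la nu b → Star (SkewAdj la nu) a b)
  × (∀ i j → ¬ (InSkew la nu (i , j) × InSkew la nu (suc i , j)
                × InSkew la nu (i , suc j) × InSkew la nu (suc i , suc j)))

stripSize : List ℕ → List ℕ → ℕ
stripSize la nu = sum la ∸ sum nu

stripHeight : List ℕ → List ℕ → ℕ
stripHeight la nu =
  length (filterᵇ (λ i → part nu i <ᵇ part la i) (applyUpTo suc (length la))) ∸ 1

-- Greedy la z : z is the sum of the heights of the border strips of some
-- greedy border strip tableau of la (remove a largest border strip, repeat)
data Greedy : List ℕ → ℕ → Set where
  done : Greedy [] 0
  step : ∀ {la nu z} → IsBorderStrip la nu
       → (∀ nu' → IsBorderStrip la nu' → stripSize la nu' ≤ stripSize la nu)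
       → Greedy nu z → Greedy la (stripHeight la nu + z)

sumℤ : List ℤ → ℤ
sumℤ = foldr ℤ._+_ 0ℤ

prodℤ : List ℤ → ℤ
prodℤ = foldr ℤ._*_ 1ℤ

sign : ℕ → ℤ
sign n = -1ℤ ℤ.^ n

powerSum : {N : ℕ} → (Fin N → ℤ) → ℕ → ℤ
powerSum {N} x r = sumℤ (map (λ j → x j ℤ.^ r) (allFin N))

powerSumP : {N : ℕ} → (Fin N → ℤ) → List ℕ → ℤ
powerSumP x mu = prodℤ (map (powerSum x) mu)

labellings : (N k : ℕ) → List (List (Fin N))
labellings N zero    = [] ∷ []
labellings N (suc k) = concatMap (λ a → map (a ∷_) (labellings N k)) (allFin N)

monomial : {N : ℕ} → (Fin N → ℤ) → List Interval → List (Fin N) → ℤ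
monomial x I α = prodℤ (zipWith (λ uv a → x a ℤ.^ (proj₂ uv ∸ proj₁ uv)) I α)

{-# OPTIONS --safe #-}
module Submission where

-- Once c_μ is unfolded, the identity is the statement that, for each interval
-- set I of type μ, summing x^(I,α) over all labellings α expands the product
-- ∏ p_{v_i - u_i} = p_μ; the crossing signs and the global sign (-1)^z(λ) are
-- constant factors that pass through every sum. Hence only the type of the
-- interval sets matters, not λ, z, or the other properties of Is.

open import Defs
open import Data.Nat using (ℕ; _∸_)
open import Data.Integer as ℤ using (ℤ; _*_; _+_)
open import Data.Integer.Properties
  using (+-identityˡ; +-assoc; *-assoc; *-zeroˡ; *-zeroʳ; *-distribˡ-+; *-distribʳ-+;
         *-1-commutativeMonoid)
open import Data.Fin using (Fin)
open import Data.List using (List; []; _∷_; _++_; map; length; concatMap; zipWith; allFin)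
open import Data.List.Properties using (map-++; map-∘; map-cong; map-cong-local)
open import Data.List.Membership.Propositional using (_∈_)
import Data.List.Relation.Unary.All as All
open import Data.List.Relation.Unary.Unique.Propositional using (Unique)
open import Data.List.Relation.Binary.Permutation.Propositional using (_↭_; ↭⇒↭ₛ)
import Data.List.Relation.Binary.Permutation.Propositional.Properties as ↭
open import Data.List.Relation.Binary.Permutation.Setoid.Properties using (foldr-commMonoid)
open import Algebra.Bundles using (CommutativeMonoid)
open import Data.Product using (_×_; proj₁; proj₂)
open import Function.Base using (_∘_)
open import Function.Bundles using (_⇔_; Equivalence)
open import Relation.Binary.PropositionalEquality using (_≡_; refl; sym; cong)
open import Relation.Binary.PropositionalEquality.Properties using (module ≡-Reasoning)

open ≡-Reasoning

private
  variable
    A B : Set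

sumℤ-++ : (xs ys : List ℤ) → sumℤ (xs ++ ys) ≡ sumℤ xs + sumℤ ys
sumℤ-++ []       ys = sym (+-identityˡ _)
sumℤ-++ (x ∷ xs) ys = begin
  x + sumℤ (xs ++ ys)        ≡⟨ cong (x +_) (sumℤ-++ xs ys) ⟩
  x + (sumℤ xs + sumℤ ys)    ≡⟨ +-assoc x _ _ ⟨
  (x + sumℤ xs) + sumℤ ys    ∎

sumℤ-map-concatMap : (f : A → List B) (g : B → ℤ) (xs : List A) →
  sumℤ (map g (concatMap f xs)) ≡ sumℤ (map (λ a → sumℤ (map g (f a))) xs)
sumℤ-map-concatMap f g []       = refl
sumℤ-map-concatMap f g (x ∷ xs) = begin
  sumℤ (map g (f x ++ concatMap f xs))
    ≡⟨ cong sumℤ (map-++ g (f x) _) ⟩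
  sumℤ (map g (f x) ++ map g (concatMap f xs))
    ≡⟨ sumℤ-++ (map g (f x)) _ ⟩
  sumℤ (map g (f x)) + sumℤ (map g (concatMap f xs))
    ≡⟨ cong (sumℤ (map g (f x)) +_) (sumℤ-map-concatMap f g xs) ⟩
  sumℤ (map (λ a → sumℤ (map g (f a))) (x ∷ xs)) ∎

sumℤ-map-*ˡ : (c : ℤ) (g : A → ℤ) (xs : List A) →
  sumℤ (map (λ a → c * g a) xs) ≡ c * sumℤ (map g xs)
sumℤ-map-*ˡ c g []       = sym (*-zeroʳ c)
sumℤ-map-*ˡ c g (x ∷ xs) = begin
  c * g x + sumℤ (map (λ a → c * g a) xs)  ≡⟨ cong (c * g x +_) (sumℤ-map-*ˡ c g xs) ⟩
  c * g x + c * sumℤ (map g xs)            ≡⟨ *-distribˡ-+ c _ _ ⟨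
  c * sumℤ (map g (x ∷ xs))                ∎

sumℤ-map-*ʳ : (c : ℤ) (g : A → ℤ) (xs : List A) →
  sumℤ (map (λ a → g a * c) xs) ≡ sumℤ (map g xs) * c
sumℤ-map-*ʳ c g []       = sym (*-zeroˡ c)
sumℤ-map-*ʳ c g (x ∷ xs) = begin
  g x * c + sumℤ (map (λ a → g a * c) xs)  ≡⟨ cong (g x * c +_) (sumℤ-map-*ʳ c g xs) ⟩
  g x * c + sumℤ (map g xs) * c            ≡⟨ *-distribʳ-+ c (g x) _ ⟨
  sumℤ (map g (x ∷ xs)) * c                ∎

prodℤ-↭ : {xs ys : List ℤ} → xs ↭ ys → prodℤ xs ≡ prodℤ ys
prodℤ-↭ p = foldr-commMonoid ℤ-*-1.setoid ℤ-*-1.isCommutativeMonoid (↭⇒↭ₛ p)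
  where module ℤ-*-1 = CommutativeMonoid *-1-commutativeMonoid

sumℤ-labellings-prodℤ : {N : ℕ} (g : A → Fin N → ℤ) (as : List A) →
  sumℤ (map (λ α → prodℤ (zipWith g as α)) (labellings N (length as)))
  ≡ prodℤ (map (λ a → sumℤ (map (g a) (allFin N))) as)
sumℤ-labellings-prodℤ         g []       = refl
sumℤ-labellings-prodℤ {N = N} g (a ∷ as) = begin
  sumℤ (map F (concatMap (λ b → map (b ∷_) Λ) (allFin N)))
    ≡⟨ sumℤ-map-concatMap (λ b → map (b ∷_) Λ) F (allFin N) ⟩
  sumℤ (map (λ b → sumℤ (map F (map (b ∷_) Λ))) (allFin N))
    ≡⟨ cong sumℤ (map-cong first-label-factors (allFin N)) ⟩
  sumℤ (map (λ b → g a b * P) (allFin N))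
    ≡⟨ sumℤ-map-*ʳ P (g a) (allFin N) ⟩
  sumℤ (map (g a) (allFin N)) * P ∎
  where
  Λ = labellings N (length as)
  F = λ α → prodℤ (zipWith g (a ∷ as) α)
  P = prodℤ (map (λ c → sumℤ (map (g c) (allFin N))) as)

  first-label-factors : ∀ b → sumℤ (map F (map (b ∷_) Λ)) ≡ g a b * P
  first-label-factors b = begin
    sumℤ (map F (map (b ∷_) Λ))
      ≡⟨ cong sumℤ (map-∘ Λ) ⟨
    sumℤ (map (λ α → g a b * prodℤ (zipWith g as α)) Λ)
      ≡⟨ sumℤ-map-*ˡ (g a b) (λ α → prodℤ (zipWith g as α)) Λ ⟩
    g a b * sumℤ (map (λ α → prodℤ (zipWith g as α)) Λ)
      ≡⟨ cong (g a b *_) (sumℤ-labellings-prodℤ g as) ⟩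
    g a b * P ∎

intervalLength : Interval → ℕ
intervalLength uv = proj₂ uv ∸ proj₁ uv

sumℤ-monomial≡powerSumP : {N : ℕ} (x : Fin N → ℤ) (mu : List ℕ) (I : List Interval) →
  OfType mu I → sumℤ (map (monomial x I) (labellings N (length I))) ≡ powerSumP x mu
sumℤ-monomial≡powerSumP x mu I I∶mu = begin
  sumℤ (map (monomial x I) (labellings _ (length I)))
    ≡⟨ sumℤ-labellings-prodℤ (λ uv a → x a ℤ.^ intervalLength uv) I ⟩
  prodℤ (map (λ uv → powerSum x (intervalLength uv)) I)
    ≡⟨ cong prodℤ (map-∘ I) ⟩
  powerSumP x (map intervalLength I)
    ≡⟨ prodℤ-↭ (↭.map⁺ (powerSum x) I∶mu) ⟩
  powerSumP x mu ∎

lemma7p3 : (la mu : List ℕ) (k : ℕ) → IsPartition la → rank la ≡ k → IsPartition mu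
    → (z : ℕ) → Greedy la z
    → (Is : List (List Interval)) → Unique Is
    → (∀ I → (I ∈ Is) ⇔ (IsIntervalSet (SS la) I × OfType mu I))
    → (N : ℕ) (x : Fin N → ℤ)
    → (sign z * sumℤ (map (λ I → sign (crossing I)) Is)) * powerSumP x mu
      ≡ sign z * sumℤ (map (λ I → sumℤ (map (λ α → sign (crossing I) * monomial x I α)
                                              (labellings N (length I)))) Is)
lemma7p3 la mu _ _ _ _ z _ Is _ Is-spec N x = begin
  (sign z * sumℤ (map (sign ∘ crossing) Is)) * powerSumP x mu
    ≡⟨ *-assoc (sign z) _ _ ⟩
  sign z * (sumℤ (map (sign ∘ crossing) Is) * powerSumP x mu)
    ≡⟨ cong (sign z *_) (sumℤ-map-*ʳ (powerSumP x mu) (sign ∘ crossing) Is) ⟨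
  sign z * sumℤ (map (λ I → sign (crossing I) * powerSumP x mu) Is)
    ≡⟨ cong (λ s → sign z * sumℤ s) (map-cong-local (All.tabulate expand)) ⟩
  sign z * sumℤ (map (λ I → sumℤ (map (λ α → sign (crossing I) * monomial x I α)
                                      (labellings N (length I)))) Is) ∎
  where
  expand : ∀ {I} → I ∈ Is →
    sign (crossing I) * powerSumP x mu
    ≡ sumℤ (map (λ α → sign (crossing I) * monomial x I α) (labellings N (length I)))
  expand {I} I∈Is = begin
    sign (crossing I) * powerSumP x mu
      ≡⟨ cong (sign (crossing I) *_) (sumℤ-monomial≡powerSumP x mu I I∶mu) ⟨
    sign (crossing I) * sumℤ (map (monomial x I) (labellings N (length I)))
      ≡⟨ sumℤ-map-*ˡ (sign (crossing I)) (monomial x I) (labellings N (length I)) ⟨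
    sumℤ (map (λ α → sign (crossing I) * monomial x I α) (labellings N (length I))) ∎
    where I∶mu = proj₂ (Equivalence.to (Is-spec I) I∈Is)
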